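{- Let $Q$ be an IPC formula and $\theta = (Z_N, \dots, Z_0)$ a finite sequence of IPC formulas, each of the form $QW$ or $QQW$ for some IPC formula $W$. Suppose some term of $\theta$ is a formula $\beta = QQ(X \supset Y)$ for IPC formulas $X, Y$, and put $\beta_0 = QX$, $\beta_1 = QQY$. If both $\mathcal{D}(\beta_0, \theta)$ and $\mathcal{D}(\beta_1, \theta)$ are theorems of IPC, then $\mathcal{D}(\theta)$ is a theorem of IPC.
   Context: The Implicational Propositional Calculus (IPC) has formulas built from propositional variables using only $\supset$, the single inference rule modus ponens, and the axiom schemes $X \supset (Y \supset X)$, $[X \supset (Y \supset Z)] \supset [(X \supset Y) \supset (X \supset Z)]$ and $[(X \supset Y) \supset X] \supset X$. For an IPC formula $Z$ write $QZ := Z \supset Q$, so $QQZ = (Z \supset Q)\supset Q$. For a sequence $\theta = (Z_N, \dots, Z_0)$ of IPC formulas, $\mathcal{D}(\theta) := Z_N \supset (Z_{N-1} \supset ( \cdots (Z_0 \supset Q) \cdots ))$, and for a formula $W$, $(W,\theta)$ denotes the sequence $(W, Z_N, \dots, Z_0)$, so $\mathcal{D}(W,\theta) = W \supset \mathcal{D}(\theta)$. -}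

module Defs where

open import Data.Nat using (ℕ)
open import Data.List using (List; []; _∷_)

infixr 5 _⊃_

data Formula : Set where
  var : ℕ → Formula
  _⊃_ : Formula → Formula → Formula

data ⊢_ : Formula → Set where
  ax1 : ∀ X Y → ⊢ (X ⊃ (Y ⊃ X))
  ax2 : ∀ X Y Z → ⊢ ((X ⊃ (Y ⊃ Z)) ⊃ ((X ⊃ Y) ⊃ (X ⊃ Z)))
  ax3 : ∀ X Y → ⊢ (((X ⊃ Y) ⊃ X) ⊃ X)
  mp  : ∀ {X Y} → ⊢ (X ⊃ Y) → ⊢ X → ⊢ Y

Q· : Formula → Formula → Formula
Q· Q Z = Z ⊃ Q

-- A sequence θ = (Z_N, …, Z_0) is a list whose head is Z_N.
-- 𝒟 Q θ = Z_N ⊃ (Z_{N-1} ⊃ ( … (Z_0 ⊃ Q) … ))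
𝒟 : Formula → List Formula → Formula
𝒟 Q []      = Q
𝒟 Q (Z ∷ θ) = Z ⊃ 𝒟 Q θ

module Submission where

-- Reason inside IPC with hypotheses.  Write Γ ⊩ A for "A is
-- derivable by modus ponens from theorems of IPC and the formulas of Γ".  By
-- the deduction theorem (which needs only the first two axiom schemes),
--   ⊢ 𝒟 Q θ   iff   θ ⊩ Q,
-- so it suffices to derive Q from the hypotheses θ.  From the two assumed
-- theorems we get  θ ⊩ QQX  and  θ ⊩ QQQY.  Now assume X ⊃ Y.  Since
-- Y ⊃ QQY, we get X ⊃ QQY, hence X ⊃ Q using QQQY = QQY ⊃ Q, hence Q using
-- QQX = (X ⊃ Q) ⊃ Q.  Discharging X ⊃ Y yields Q(X ⊃ Y), and the hypothesis
-- β = QQ(X ⊃ Y) ∈ θ turns this into Q.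

open import Defs
open import Data.Product using (Σ)
open import Data.Sum using (_⊎_)
open import Data.List using (List; []; _∷_; _++_)
open import Data.List.Relation.Unary.All using (All)
open import Data.List.Relation.Unary.Any using (here; there)
open import Data.List.Membership.Propositional using (_∈_)
open import Data.List.Relation.Binary.Subset.Propositional using (_⊆_)
open import Data.List.Relation.Binary.Subset.Propositional.Properties
  using (⊆-refl; ⊆-reflexive-↭; xs⊆x∷xs; xs⊆xs++ys)
open import Data.List.Relation.Binary.Permutation.Propositional.Properties
  using (shift)
open import Data.List.Relation.Binary.Permutation.Propositional using (↭-sym)
open import Relation.Binary.PropositionalEquality using (_≡_; refl)

infix 3 _⊩_
data _⊩_ (Γ : List Formula) : Formula → Set where
  hyp : ∀ {A} → A ∈ Γ → Γ ⊩ A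
  thm : ∀ {A} → ⊢ A → Γ ⊩ A
  app : ∀ {A B} → Γ ⊩ A ⊃ B → Γ ⊩ A → Γ ⊩ B

weaken : ∀ {Γ Δ A} → Γ ⊆ Δ → Γ ⊩ A → Δ ⊩ A
weaken Γ⊆Δ (hyp A∈Γ) = hyp (Γ⊆Δ A∈Γ)
weaken Γ⊆Δ (thm ⊢A)  = thm ⊢A
weaken Γ⊆Δ (app d e) = app (weaken Γ⊆Δ d) (weaken Γ⊆Δ e)

closed : ∀ {A} → [] ⊩ A → ⊢ A
closed (hyp ())
closed (thm ⊢A)  = ⊢A
closed (app d e) = mp (closed d) (closed e)

-- The identity A ⊃ A, from the first two axiom schemes (S K K).
identity : ∀ A → ⊢ (A ⊃ A)
identity A = mp (mp (ax2 A (A ⊃ A) A) (ax1 A (A ⊃ A))) (ax1 A A)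

deduction : ∀ {Γ A B} → A ∷ Γ ⊩ B → Γ ⊩ A ⊃ B
deduction {A = A} (hyp (here refl)) = thm (identity A)
deduction {A = A} (hyp (there B∈Γ)) = app (thm (ax1 _ A)) (hyp B∈Γ)
deduction {A = A} (thm ⊢B)          = app (thm (ax1 _ A)) (thm ⊢B)
deduction {A = A} (app {C} {D} d e) =
  app (app (thm (ax2 A C D)) (deduction d)) (deduction e)

compose : ∀ {Γ A B C} → Γ ⊩ B ⊃ C → Γ ⊩ A ⊃ B → Γ ⊩ A ⊃ C
compose g f = deduction (app (weaken (xs⊆x∷xs _ _) g)
                             (app (weaken (xs⊆x∷xs _ _) f) (hyp (here refl))))

QQ-intro : ∀ {Γ} Q A → Γ ⊩ A ⊃ Q· Q (Q· Q A)
QQ-intro Q A = deduction (deduction (app (hyp (here refl)) (hyp (there (here refl)))))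

𝒟-elim : ∀ Q θ {Γ} → Γ ⊩ 𝒟 Q θ → θ ⊆ Γ → Γ ⊩ Q
𝒟-elim Q []      d θ⊆Γ = d
𝒟-elim Q (Z ∷ θ) d Zθ⊆Γ =
  𝒟-elim Q θ (app d (hyp (Zθ⊆Γ (here refl)))) (λ A∈θ → Zθ⊆Γ (there A∈θ))

𝒟-intro : ∀ Q θ Γ → θ ++ Γ ⊩ Q → Γ ⊩ 𝒟 Q θ
𝒟-intro Q []      Γ d = d
𝒟-intro Q (Z ∷ θ) Γ d =
  deduction (𝒟-intro Q θ (Z ∷ Γ) (weaken (⊆-reflexive-↭ (↭-sym (shift Z θ Γ))) d))

𝒟-hyps : ∀ Q θ → ⊢ 𝒟 Q θ → θ ⊩ Q
𝒟-hyps Q θ ⊢𝒟 = 𝒟-elim Q θ (thm ⊢𝒟) ⊆-refl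

𝒟-closed : ∀ Q θ → θ ⊩ Q → ⊢ 𝒟 Q θ
𝒟-closed Q θ d = closed (𝒟-intro Q θ [] (weaken (xs⊆xs++ys θ []) d))

𝒟-cons-hyps : ∀ Q W θ → ⊢ 𝒟 Q (W ∷ θ) → θ ⊩ Q· Q W
𝒟-cons-hyps Q W θ ⊢𝒟 = deduction (𝒟-hyps Q (W ∷ θ) ⊢𝒟)

QQ-imp-elim : ∀ {Γ} Q X Y
  → Γ ⊩ Q· Q (Q· Q (X ⊃ Y))
  → Γ ⊩ Q· Q (Q· Q X)
  → Γ ⊩ Q· Q (Q· Q (Q· Q Y))
  → Γ ⊩ Q
QQ-imp-elim {Γ} Q X Y β qqX qqqY = app β (deduction Q-under-X⊃Y)
  where
  lift : ∀ {A} → Γ ⊩ A → (X ⊃ Y) ∷ Γ ⊩ A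
  lift = weaken (xs⊆x∷xs _ _)

  X⊃QQY : (X ⊃ Y) ∷ Γ ⊩ X ⊃ Q· Q (Q· Q Y)
  X⊃QQY = compose (QQ-intro Q Y) (hyp (here refl))

  Q-under-X⊃Y : (X ⊃ Y) ∷ Γ ⊩ Q
  Q-under-X⊃Y = app (lift qqX) (compose (lift qqqY) X⊃QQY)

theorem9 : (Q : Formula) (θ : List Formula)
    → All (λ Z → Σ Formula (λ W → (Z ≡ Q· Q W) ⊎ (Z ≡ Q· Q (Q· Q W)))) θ
    → (X Y : Formula)
    → Q· Q (Q· Q (X ⊃ Y)) ∈ θ
    → ⊢ 𝒟 Q (Q· Q X ∷ θ)
    → ⊢ 𝒟 Q (Q· Q (Q· Q Y) ∷ θ)
    → ⊢ 𝒟 Q θ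
theorem9 Q θ _ X Y β∈θ ⊢𝒟β₀ ⊢𝒟β₁ =
  𝒟-closed Q θ
    (QQ-imp-elim Q X Y (hyp β∈θ)
      (𝒟-cons-hyps Q (Q· Q X) θ ⊢𝒟β₀)
      (𝒟-cons-hyps Q (Q· Q (Q· Q Y)) θ ⊢𝒟β₁))
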